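{- Let $k\ge 0$ and $n>0$ be integers, and let $\sigma$ be the substitution of $\{a,b,c\}^\ast$ given by $\sigma(a)=a^kba$, $\sigma(b)=a^kca$, $\sigma(c)=(a^kba\,a^kca)^{n-1}a^kba\,a^kc$ (so $\sigma(a)|\sigma(b)||\sigma(c)$ is the mode $v_{k,n}=a^kba|a^kca||(a^kba\,a^kca)^{n-1}a^kba\,a^kc$). Let $f=G^kDG^{2n}$ acting on $\{a,c\}^\ast$, $g=G^{2k+2}DG^{n-1}$ acting on $\{b,c\}^\ast$, and $\tilde g=G^k\tilde G^{k+2}DG^{n-1}$ acting on $\{a,b\}^\ast$. Then $\pi_{b\to c}(\sigma(a))=f(a)$ and $\pi_{b\to c}(\sigma(bc))=f(c)$; $\pi_{a\to b}(\sigma(ab))=g(b)$ and $\pi_{a\to b}(\sigma(c))=g(c)$; $\pi_{c\to a}(\sigma(ab))=\tilde g(a)$ and $\pi_{c\to a}(\sigma(c))=\tilde g(b)$.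
   Context: $\pi_{x\to y}$ is the monoid morphism of $\{a,b,c\}^\ast$ replacing each $x$ by $y$ and fixing the other letters. For an ordered two-letter alphabet $(x,y)$, $G: x\mapsto x,\ y\mapsto xy$; $\tilde G: x\mapsto x,\ y\mapsto yx$; $D: x\mapsto yx,\ y\mapsto y$; products denote composition of morphisms. The orders used are $(a,c)$ for $f$, $(b,c)$ for $g$, and $(a,b)$ for $\tilde g$ (so e.g. on $\{a,c\}^\ast$: $G(a)=a, G(c)=ac, D(a)=ca, D(c)=c$). -}

module Defs where

open import Data.Nat using (ℕ; zero; suc; _+_; _*_; _∸_)
open import Data.List using (List; []; _∷_; _++_; concatMap)
open import Relation.Nullary using (yes; no)
open import Relation.Binary.PropositionalEquality using (_≡_; refl)

data Letter : Set where
  a b c : Letter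

_≟L_ : (x y : Letter) → Relation.Nullary.Dec (x ≡ y)
a ≟L a = yes refl
a ≟L b = no λ ()
a ≟L c = no λ ()
b ≟L a = no λ ()
b ≟L b = yes refl
b ≟L c = no λ ()
c ≟L a = no λ ()
c ≟L b = no λ ()
c ≟L c = yes refl

Word : Set
Word = List Letter

Morphism : Set
Morphism = Word → Word

ext : (Letter → Word) → Morphism
ext h = concatMap h

_^w_ : Word → ℕ → Word
u ^w zero = []
u ^w suc m = u ++ (u ^w m)

iter : ℕ → Morphism → Morphism
iter zero φ w = w
iter (suc m) φ w = φ (iter m φ w)

rep : Letter → Letter → Letter → Letter
rep x y z with z ≟L x
... | yes _ = y
... | no _  = z

π : Letter → Letter → Morphism
π x y = ext λ z → rep x y z ∷ []

-- For an ordered two-letter alphabet (x,y) (other letters fixed):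
-- G : x ↦ x, y ↦ xy
Gimg : Letter → Letter → Letter → Word
Gimg x y z with z ≟L y
... | yes _ = x ∷ y ∷ []
... | no _  = z ∷ []

G : Letter → Letter → Morphism
G x y = ext (Gimg x y)

G̃img : Letter → Letter → Letter → Word
G̃img x y z with z ≟L y
... | yes _ = y ∷ x ∷ []
... | no _  = z ∷ []

G̃ : Letter → Letter → Morphism
G̃ x y = ext (G̃img x y)

Dimg : Letter → Letter → Letter → Word
Dimg x y z with z ≟L x
... | yes _ = y ∷ x ∷ []
... | no _  = z ∷ []

D : Letter → Letter → Morphism
D x y = ext (Dimg x y)

σimg : ℕ → ℕ → Letter → Word
σimg k n a = ((a ∷ []) ^w k) ++ (b ∷ a ∷ [])
σimg k n b = ((a ∷ []) ^w k) ++ (c ∷ a ∷ [])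
σimg k n c =
  ((((a ∷ []) ^w k) ++ (b ∷ a ∷ []) ++ ((a ∷ []) ^w k) ++ (c ∷ a ∷ [])) ^w (n ∸ 1))
  ++ ((a ∷ []) ^w k) ++ (b ∷ a ∷ []) ++ ((a ∷ []) ^w k) ++ (c ∷ [])

σ : ℕ → ℕ → Morphism
σ k n = ext (σimg k n)

f : ℕ → ℕ → Morphism
f k n w = iter k (G a c) (D a c (iter (2 * n) (G a c) w))

g : ℕ → ℕ → Morphism
g k n w = iter (2 * k + 2) (G b c) (D b c (iter (n ∸ 1) (G b c) w))

g̃ : ℕ → ℕ → Morphism
g̃ k n w = iter k (G a b) (iter (k + 2) (G̃ a b) (D a b (iter (n ∸ 1) (G a b) w)))

-- All maps involved are morphisms of {a,b,c}*, so everything reduces to images of letters.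
-- With t = a^k b a a^k c one has σ(ab) = t a and σ(c) = (t a)^(n-1) t, while for a morphism ψ
-- the word ψ D G^j (over (x,y)) sends x to ψ(yx) and y to ψ(yx)^j ψ(y).  So for g and g̃ it
-- suffices that the projection sends t to ψ(y) and a to ψ(x), a rearrangement of powers of a
-- single letter.  For f the image of b in σ(bc) is one more factor ψ(ca), which turns the
-- 2(n-1) + 1 factors of σ(c) into the exponent 2n.
module Submission where

open import Defs
open import Data.Nat using (ℕ; _>_; zero; suc; _+_; _*_)
open import Data.Nat.Properties using (+-comm; +-suc; *-suc)
open import Data.Nat.Tactic.RingSolver using (solve-∀)
open import Data.List using ([]; _∷_; _++_)
open import Data.List.Properties using (++-assoc; ++-identityʳ)
open import Data.Product using (_×_; _,_)
open import Relation.Binary.PropositionalEquality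
  using (_≡_; refl; sym; trans; cong; cong₂; module ≡-Reasoning)
open ≡-Reasoning

_^ˡ_ : Letter → ℕ → Word
x ^ˡ m = (x ∷ []) ^w m

^w-+ : ∀ (u : Word) p q → u ^w (p + q) ≡ u ^w p ++ u ^w q
^w-+ u zero    q = refl
^w-+ u (suc p) q = trans (cong (u ++_) (^w-+ u p q)) (sym (++-assoc u (u ^w p) (u ^w q)))

^w-comm : ∀ (u : Word) m → u ^w m ++ u ≡ u ++ u ^w m
^w-comm u zero    = sym (++-identityʳ u)
^w-comm u (suc m) = trans (++-assoc u (u ^w m) u) (cong (u ++_) (^w-comm u m))

^w-double : ∀ (u : Word) m → u ^w (2 * m) ≡ (u ++ u) ^w m
^w-double u zero    = refl
^w-double u (suc m) = begin
  u ++ u ^w (m + suc (m + 0))  ≡⟨ cong (λ i → u ++ u ^w i) (+-suc m (m + 0)) ⟩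
  u ++ u ++ u ^w (2 * m)       ≡⟨ cong (λ w → u ++ u ++ w) (^w-double u m) ⟩
  u ++ u ++ (u ++ u) ^w m      ≡⟨ sym (++-assoc u u _) ⟩
  (u ++ u) ^w suc m            ∎

^w-2*suc : ∀ (u t : Word) m → u ++ (u ++ u) ^w m ++ u ++ t ≡ u ^w (2 * suc m) ++ t
^w-2*suc u t m = begin
  u ++ (u ++ u) ^w m ++ u ++ t      ≡⟨ cong (λ w → u ++ w ++ u ++ t) (^w-double u m) ⟨
  u ++ u ^w (2 * m) ++ u ++ t       ≡⟨ cong (u ++_) (++-assoc (u ^w (2 * m)) u t) ⟨
  u ++ (u ^w (2 * m) ++ u) ++ t     ≡⟨ cong (λ w → u ++ w ++ t) (^w-comm u (2 * m)) ⟩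
  u ++ (u ++ u ^w (2 * m)) ++ t     ≡⟨ ++-assoc u (u ++ u ^w (2 * m)) t ⟨
  u ^w (2 + 2 * m) ++ t             ≡⟨ cong (λ i → u ^w i ++ t) (*-suc 2 m) ⟨
  u ^w (2 * suc m) ++ t             ∎

record IsWordHom (φ : Morphism) : Set where
  field
    ε-homo  : φ [] ≡ []
    ++-homo : ∀ u v → φ (u ++ v) ≡ φ u ++ φ v

  ^w-homo : ∀ u m → φ (u ^w m) ≡ φ u ^w m
  ^w-homo u zero    = ε-homo
  ^w-homo u (suc m) = trans (++-homo u (u ^w m)) (cong (φ u ++_) (^w-homo u m))

  ^ˡ-homo : ∀ {x} → φ (x ∷ []) ≡ x ∷ [] → ∀ m → φ (x ^ˡ m) ≡ x ^ˡ m
  ^ˡ-homo {x} φx m = trans (^w-homo (x ∷ []) m) (cong (_^w m) φx)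

open IsWordHom

ext-isWordHom : ∀ h → IsWordHom (ext h)
ext-isWordHom h = record { ε-homo = refl ; ++-homo = ext-++ }
  where
  ext-++ : ∀ u v → ext h (u ++ v) ≡ ext h u ++ ext h v
  ext-++ []      v = refl
  ext-++ (x ∷ u) v = trans (cong (h x ++_) (ext-++ u v)) (sym (++-assoc (h x) (ext h u) (ext h v)))

G-isWordHom : ∀ x y → IsWordHom (G x y)
G-isWordHom x y = ext-isWordHom (Gimg x y)

G̃-isWordHom : ∀ x y → IsWordHom (G̃ x y)
G̃-isWordHom x y = ext-isWordHom (G̃img x y)

D-isWordHom : ∀ x y → IsWordHom (D x y)
D-isWordHom x y = ext-isWordHom (Dimg x y)

π-isWordHom : ∀ x y → IsWordHom (π x y)
π-isWordHom x y = ext-isWordHom _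

∘-isWordHom : ∀ {φ ψ} → IsWordHom φ → IsWordHom ψ → IsWordHom (λ w → φ (ψ w))
∘-isWordHom {φ} {ψ} φ-hom ψ-hom = record
  { ε-homo  = trans (cong φ (ε-homo ψ-hom)) (ε-homo φ-hom)
  ; ++-homo = λ u v → trans (cong φ (++-homo ψ-hom u v)) (++-homo φ-hom (ψ u) (ψ v))
  }

iter-isWordHom : ∀ {φ} m → IsWordHom φ → IsWordHom (iter m φ)
iter-isWordHom zero    φ-hom = record { ε-homo = refl ; ++-homo = λ _ _ → refl }
iter-isWordHom (suc m) φ-hom = ∘-isWordHom φ-hom (iter-isWordHom m φ-hom)

iter-fixes : ∀ {φ : Morphism} {w} m → φ w ≡ w → iter m φ w ≡ w
iter-fixes         zero    φw = refl
iter-fixes {φ} {w} (suc m) φw = trans (cong φ (iter-fixes {φ} {w} m φw)) φw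

module _ {γ : Morphism} (γ-hom : IsWordHom γ) {x y : Letter} (γx : γ (x ∷ []) ≡ x ∷ []) where

  iter-G : γ (y ∷ []) ≡ x ∷ y ∷ [] → ∀ m → iter m γ (y ∷ []) ≡ x ^ˡ m ++ y ∷ []
  iter-G γy zero    = refl
  iter-G γy (suc m) = begin
    γ (iter m γ (y ∷ []))            ≡⟨ cong γ (iter-G γy m) ⟩
    γ (x ^ˡ m ++ y ∷ [])             ≡⟨ ++-homo γ-hom (x ^ˡ m) (y ∷ []) ⟩
    γ (x ^ˡ m) ++ γ (y ∷ [])         ≡⟨ cong₂ _++_ (^ˡ-homo γ-hom γx m) γy ⟩
    x ^ˡ m ++ x ∷ y ∷ []             ≡⟨ sym (++-assoc (x ^ˡ m) (x ∷ []) (y ∷ [])) ⟩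
    (x ^ˡ m ++ x ∷ []) ++ y ∷ []     ≡⟨ cong (_++ y ∷ []) (^w-comm (x ∷ []) m) ⟩
    x ^ˡ suc m ++ y ∷ []             ∎

  iter-G̃ : γ (y ∷ []) ≡ y ∷ x ∷ [] → ∀ m → iter m γ (y ∷ []) ≡ y ∷ x ^ˡ m
  iter-G̃ γy zero    = refl
  iter-G̃ γy (suc m) = begin
    γ (iter m γ (y ∷ []))            ≡⟨ cong γ (iter-G̃ γy m) ⟩
    γ (y ∷ x ^ˡ m)                   ≡⟨ ++-homo γ-hom (y ∷ []) (x ^ˡ m) ⟩
    γ (y ∷ []) ++ γ (x ^ˡ m)         ≡⟨ cong₂ _++_ γy (^ˡ-homo γ-hom γx m) ⟩
    y ∷ x ^ˡ suc m                   ∎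

π-^ˡ-++ : ∀ u v x m w → π u v (x ^ˡ m ++ w) ≡ rep u v x ^ˡ m ++ π u v w
π-^ˡ-++ u v x m w =
  trans (++-homo (π-isWordHom u v) (x ^ˡ m) w) (cong (_++ π u v w) (^w-homo (π-isWordHom u v) (x ∷ []) m))

module _ (k : ℕ) where

  Tail : Letter → Letter → Letter → Word
  Tail x y z = x ^ˡ k ++ y ∷ x ∷ x ^ˡ k ++ z ∷ []

  Tail-snoc : ∀ x y z → Tail x y z ++ x ∷ [] ≡ x ^ˡ k ++ y ∷ x ∷ x ^ˡ k ++ z ∷ x ∷ []
  Tail-snoc x y z = trans (++-assoc (x ^ˡ k) _ _) (cong (λ w → x ^ˡ k ++ y ∷ x ∷ w) (++-assoc (x ^ˡ k) _ _))

  σ-ab-unfold : ∀ n → σ k n (a ∷ b ∷ []) ≡ a ^ˡ k ++ b ∷ a ∷ a ^ˡ k ++ c ∷ a ∷ []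
  σ-ab-unfold n = trans (cong (σimg k n a ++_) (++-identityʳ _)) (++-assoc (a ^ˡ k) (b ∷ a ∷ []) _)

  σ-ab : ∀ n → σ k n (a ∷ b ∷ []) ≡ Tail a b c ++ a ∷ []
  σ-ab n = trans (σ-ab-unfold n) (sym (Tail-snoc a b c))

  σ-c : ∀ m → σ k (suc m) (c ∷ []) ≡ σ k (suc m) (a ∷ b ∷ []) ^w m ++ Tail a b c
  σ-c m = trans (++-identityʳ _) (cong (λ w → w ^w m ++ Tail a b c) (sym (σ-ab-unfold (suc m))))

  π-Tail : ∀ u v x y z → π u v (Tail x y z) ≡ Tail (rep u v x) (rep u v y) (rep u v z)
  π-Tail u v x y z = trans (π-^ˡ-++ u v x k _)
    (cong (λ w → rep u v x ^ˡ k ++ rep u v y ∷ rep u v x ∷ w) (π-^ˡ-++ u v x k (z ∷ [])))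

  Tail-split : ∀ x y z → Tail x y z ≡ (x ^ˡ k ++ y ∷ x ∷ []) ++ x ^ˡ k ++ z ∷ []
  Tail-split x y z = sym (++-assoc (x ^ˡ k) (y ∷ x ∷ []) _)

  Tail-xxz : ∀ x z → Tail x x z ≡ x ^ˡ (2 * k + 2) ++ z ∷ []
  Tail-xxz x z = sym (begin
    x ^ˡ (2 * k + 2) ++ z ∷ []            ≡⟨ cong (λ i → x ^ˡ i ++ z ∷ []) (exponent k) ⟩
    x ^ˡ (k + (2 + k)) ++ z ∷ []          ≡⟨ cong (_++ z ∷ []) (^w-+ (x ∷ []) k (2 + k)) ⟩
    (x ^ˡ k ++ x ∷ x ∷ x ^ˡ k) ++ z ∷ []  ≡⟨ ++-assoc (x ^ˡ k) _ _ ⟩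
    Tail x x z                            ∎)
    where
    exponent : ∀ k → 2 * k + 2 ≡ k + (2 + k)
    exponent = solve-∀

  Tail-xyx : ∀ x y → Tail x y x ≡ x ^ˡ k ++ y ∷ x ^ˡ (k + 2)
  Tail-xyx x y = cong (λ w → x ^ˡ k ++ y ∷ w)
    (trans (cong (x ∷_) (^w-comm (x ∷ []) k)) (cong (x ^ˡ_) (+-comm 2 k)))

module _ {x y : Letter} {γ δ ψ : Morphism}
         (γ-hom : IsWordHom γ) (δ-hom : IsWordHom δ) (ψ-hom : IsWordHom ψ)
         (γx : γ (x ∷ []) ≡ x ∷ []) (γy : γ (y ∷ []) ≡ x ∷ y ∷ [])
         (δx : δ (x ∷ []) ≡ y ∷ x ∷ []) (δy : δ (y ∷ []) ≡ y ∷ []) where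

  ψ∘D∘Gʲ-x : ∀ j → ψ (δ (iter j γ (x ∷ []))) ≡ ψ (y ∷ x ∷ [])
  ψ∘D∘Gʲ-x j = cong ψ (trans (cong δ (iter-fixes j γx)) δx)

  ψ∘D∘Gʲ-y : ∀ j → ψ (δ (iter j γ (y ∷ []))) ≡ ψ (y ∷ x ∷ []) ^w j ++ ψ (y ∷ [])
  ψ∘D∘Gʲ-y j = begin
    ψδ (iter j γ (y ∷ []))              ≡⟨ cong ψδ (iter-G γ-hom γx γy j) ⟩
    ψδ (x ^ˡ j ++ y ∷ [])               ≡⟨ ++-homo ψδ-hom (x ^ˡ j) (y ∷ []) ⟩
    ψδ (x ^ˡ j) ++ ψδ (y ∷ [])          ≡⟨ cong₂ _++_ (^w-homo ψδ-hom (x ∷ []) j) (cong ψ δy) ⟩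
    ψδ (x ∷ []) ^w j ++ ψ (y ∷ [])      ≡⟨ cong (λ w → ψ w ^w j ++ ψ (y ∷ [])) δx ⟩
    ψ (y ∷ x ∷ []) ^w j ++ ψ (y ∷ [])   ∎
    where
    ψδ : Morphism
    ψδ w = ψ (δ w)
    ψδ-hom : IsWordHom ψδ
    ψδ-hom = ∘-isWordHom ψ-hom δ-hom

  σ-matches : ∀ k m {φ} → IsWordHom φ →
    φ (Tail k a b c) ≡ ψ (y ∷ []) → φ (a ∷ []) ≡ ψ (x ∷ []) →
      (φ (σ k (suc m) (a ∷ b ∷ [])) ≡ ψ (δ (iter m γ (x ∷ []))))
    × (φ (σ k (suc m) (c ∷ [])) ≡ ψ (δ (iter m γ (y ∷ []))))
  σ-matches k m {φ} φ-hom φt φa = trans φσab (sym (ψ∘D∘Gʲ-x m)) , φσc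
    where
    σab : Word
    σab = σ k (suc m) (a ∷ b ∷ [])

    φσab : φ σab ≡ ψ (y ∷ x ∷ [])
    φσab = begin
      φ σab                             ≡⟨ cong φ (σ-ab k (suc m)) ⟩
      φ (Tail k a b c ++ a ∷ [])        ≡⟨ ++-homo φ-hom (Tail k a b c) (a ∷ []) ⟩
      φ (Tail k a b c) ++ φ (a ∷ [])    ≡⟨ cong₂ _++_ φt φa ⟩
      ψ (y ∷ []) ++ ψ (x ∷ [])          ≡⟨ sym (++-homo ψ-hom (y ∷ []) (x ∷ [])) ⟩
      ψ (y ∷ x ∷ [])                    ∎

    φσc : φ (σ k (suc m) (c ∷ [])) ≡ ψ (δ (iter m γ (y ∷ [])))
    φσc = begin
      φ (σ k (suc m) (c ∷ []))                ≡⟨ cong φ (σ-c k m) ⟩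
      φ (σab ^w m ++ Tail k a b c)            ≡⟨ ++-homo φ-hom (σab ^w m) (Tail k a b c) ⟩
      φ (σab ^w m) ++ φ (Tail k a b c)        ≡⟨ cong (_++ φ (Tail k a b c)) (^w-homo φ-hom σab m) ⟩
      φ σab ^w m ++ φ (Tail k a b c)          ≡⟨ cong₂ (λ u v → u ^w m ++ v) φσab φt ⟩
      ψ (y ∷ x ∷ []) ^w m ++ ψ (y ∷ [])       ≡⟨ sym (ψ∘D∘Gʲ-y m) ⟩
      ψ (δ (iter m γ (y ∷ [])))               ∎

π-a→b-σ≡g : ∀ k m →
    (π a b (σ k (suc m) (a ∷ b ∷ [])) ≡ g k (suc m) (b ∷ []))
  × (π a b (σ k (suc m) (c ∷ [])) ≡ g k (suc m) (c ∷ []))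
π-a→b-σ≡g k m =
  σ-matches (G-isWordHom b c) (D-isWordHom b c) ψ-hom refl refl refl refl k m (π-isWordHom a b) πTail πa
  where
  ψ : Morphism
  ψ = iter (2 * k + 2) (G b c)
  ψ-hom : IsWordHom ψ
  ψ-hom = iter-isWordHom (2 * k + 2) (G-isWordHom b c)

  πTail : π a b (Tail k a b c) ≡ ψ (c ∷ [])
  πTail = trans (π-Tail k a b a b c)
    (trans (Tail-xxz k b c) (sym (iter-G (G-isWordHom b c) refl refl (2 * k + 2))))

  πa : π a b (a ∷ []) ≡ ψ (b ∷ [])
  πa = sym (iter-fixes (2 * k + 2) refl)

π-c→a-σ≡g̃ : ∀ k m →
    (π c a (σ k (suc m) (a ∷ b ∷ [])) ≡ g̃ k (suc m) (a ∷ []))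
  × (π c a (σ k (suc m) (c ∷ [])) ≡ g̃ k (suc m) (b ∷ []))
π-c→a-σ≡g̃ k m =
  σ-matches (G-isWordHom a b) (D-isWordHom a b) ψ-hom refl refl refl refl k m (π-isWordHom c a) πTail πa
  where
  G-hom : IsWordHom (G a b)
  G-hom = G-isWordHom a b
  G̃-hom : IsWordHom (G̃ a b)
  G̃-hom = G̃-isWordHom a b
  ψ : Morphism
  ψ w = iter k (G a b) (iter (k + 2) (G̃ a b) w)
  ψ-hom : IsWordHom ψ
  ψ-hom = ∘-isWordHom (iter-isWordHom k G-hom) (iter-isWordHom (k + 2) G̃-hom)

  πTail : π c a (Tail k a b c) ≡ ψ (b ∷ [])
  πTail = begin
    π c a (Tail k a b c)                                ≡⟨ π-Tail k c a a b c ⟩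
    Tail k a b a                                        ≡⟨ Tail-xyx k a b ⟩
    a ^ˡ k ++ b ∷ a ^ˡ (k + 2)                          ≡⟨ ++-assoc (a ^ˡ k) (b ∷ []) _ ⟨
    (a ^ˡ k ++ b ∷ []) ++ a ^ˡ (k + 2)                  ≡⟨ cong₂ _++_ (iter-G G-hom refl refl k)
                                                             (^ˡ-homo (iter-isWordHom k G-hom) (iter-fixes k refl) (k + 2)) ⟨
    iter k (G a b) (b ∷ []) ++ iter k (G a b) (a ^ˡ (k + 2))
                                                        ≡⟨ ++-homo (iter-isWordHom k G-hom) (b ∷ []) _ ⟨
    iter k (G a b) (b ∷ a ^ˡ (k + 2))                   ≡⟨ cong (iter k (G a b)) (iter-G̃ G̃-hom refl refl (k + 2)) ⟨
    ψ (b ∷ [])                                          ∎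

  πa : π c a (a ∷ []) ≡ ψ (a ∷ [])
  πa = sym (trans (cong (iter k (G a b)) (iter-fixes (k + 2) refl)) (iter-fixes k refl))

π-b→c-σ≡f : ∀ k m →
    (π b c (σ k (suc m) (a ∷ [])) ≡ f k (suc m) (a ∷ []))
  × (π b c (σ k (suc m) (b ∷ c ∷ [])) ≡ f k (suc m) (c ∷ []))
π-b→c-σ≡f k m = trans πσa (sym fa) , trans πσbc (sym fc)
  where
  ψ : Morphism
  ψ = iter k (G a c)
  ψ-hom : IsWordHom ψ
  ψ-hom = iter-isWordHom k (G-isWordHom a c)
  σ-hom : IsWordHom (σ k (suc m))
  σ-hom = ext-isWordHom _
  π-hom : IsWordHom (π b c)
  π-hom = π-isWordHom b c

  T U : Word
  T = ψ (c ∷ [])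
  U = ψ (c ∷ a ∷ [])

  T≡ : T ≡ a ^ˡ k ++ c ∷ []
  T≡ = iter-G (G-isWordHom a c) refl refl k

  U≡ : U ≡ a ^ˡ k ++ c ∷ a ∷ []
  U≡ = trans (++-homo ψ-hom (c ∷ []) (a ∷ []))
    (trans (cong₂ _++_ T≡ (iter-fixes k refl)) (++-assoc (a ^ˡ k) (c ∷ []) (a ∷ [])))

  fa : f k (suc m) (a ∷ []) ≡ U
  fa = ψ∘D∘Gʲ-x (G-isWordHom a c) (D-isWordHom a c) ψ-hom refl refl refl refl (2 * suc m)

  fc : f k (suc m) (c ∷ []) ≡ U ^w (2 * suc m) ++ T
  fc = ψ∘D∘Gʲ-y (G-isWordHom a c) (D-isWordHom a c) ψ-hom refl refl refl refl (2 * suc m)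

  πσa : π b c (σ k (suc m) (a ∷ [])) ≡ U
  πσa = trans (cong (π b c) (++-identityʳ (σimg k (suc m) a))) (trans (π-^ˡ-++ b c a k (b ∷ a ∷ [])) (sym U≡))

  πσb : π b c (σ k (suc m) (b ∷ [])) ≡ U
  πσb = trans (cong (π b c) (++-identityʳ (σimg k (suc m) b))) (trans (π-^ˡ-++ b c a k (c ∷ a ∷ [])) (sym U≡))

  πσ-++ : ∀ u v → π b c (σ k (suc m) (u ++ v)) ≡ π b c (σ k (suc m) u) ++ π b c (σ k (suc m) v)
  πσ-++ u v = trans (cong (π b c) (++-homo σ-hom u v)) (++-homo π-hom (σ k (suc m) u) (σ k (suc m) v))

  πσc : π b c (σ k (suc m) (c ∷ [])) ≡ (U ++ U) ^w m ++ U ++ T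
  πσc = begin
    π b c (σ k (suc m) (c ∷ []))                  ≡⟨ cong (π b c) (σ-c k m) ⟩
    π b c (σab ^w m ++ Tail k a b c)              ≡⟨ ++-homo π-hom (σab ^w m) _ ⟩
    π b c (σab ^w m) ++ π b c (Tail k a b c)      ≡⟨ cong₂ _++_ (^w-homo π-hom σab m) (π-Tail k b c a b c) ⟩
    π b c σab ^w m ++ Tail k a c c                ≡⟨ cong₂ (λ u v → u ^w m ++ v) πσab Tail≡ ⟩
    (U ++ U) ^w m ++ U ++ T                       ∎
    where
    σab : Word
    σab = σ k (suc m) (a ∷ b ∷ [])
    πσab : π b c σab ≡ U ++ U
    πσab = trans (πσ-++ (a ∷ []) (b ∷ [])) (cong₂ _++_ πσa πσb)
    Tail≡ : Tail k a c c ≡ U ++ T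
    Tail≡ = trans (Tail-split k a c c) (sym (cong₂ _++_ U≡ T≡))

  πσbc : π b c (σ k (suc m) (b ∷ c ∷ [])) ≡ U ^w (2 * suc m) ++ T
  πσbc = trans (πσ-++ (b ∷ []) (c ∷ [])) (trans (cong₂ _++_ πσb πσc) (^w-2*suc U T m))

proposition7 : (k n : ℕ) → n > 0 →
    (π b c (σ k n (a ∷ [])) ≡ f k n (a ∷ []))
    × (π b c (σ k n (b ∷ c ∷ [])) ≡ f k n (c ∷ []))
    × (π a b (σ k n (a ∷ b ∷ [])) ≡ g k n (b ∷ []))
    × (π a b (σ k n (c ∷ [])) ≡ g k n (c ∷ []))
    × (π c a (σ k n (a ∷ b ∷ [])) ≡ g̃ k n (a ∷ []))
    × (π c a (σ k n (c ∷ [])) ≡ g̃ k n (b ∷ []))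
proposition7 k (suc m) _
  with π-b→c-σ≡f k m | π-a→b-σ≡g k m | π-c→a-σ≡g̃ k m
... | f-a , f-c | g-b , g-c | g̃-a , g̃-b = f-a , f-c , g-b , g-c , g̃-a , g̃-b
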